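{- Let $\mathcal{T}^*$ be a hierarchical clustering of a set $X$ with $|X|=n\ge 3$, and assume all ordinal query responses are correct. Choose a pair $(x_A,x_B)$ of distinct elements of $X$ uniformly at random, and define $A=\{x_A\}\cup\{x\in X: x \text{ and } x_A \text{ are closer to each other than to } x_B\}$, $B=\{x_B\}\cup\{x\in X: x \text{ and } x_B\text{ are closer to each other than to } x_A\}$, $C=\{x\in X: x_A \text{ and } x_B \text{ are closer to each other than to } x\}$. Then the probability that at least one of $A,B,C$ has more than $\frac{15}{16}n$ elements is at most $\frac{125}{128}$.
   Context: A hierarchical clustering of $X$ is a rooted tree whose leaves are exactly the elements of $X$ and in which every internal node has exactly two children; the cluster of a node is the set of leaves of its subtree. For distinct $x,x',x''$, $x$ and $x'$ are closer to each other than to $x''$ if some cluster of $\mathcal{T}^*$ contains $x,x'$ but not $x''$. -}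

module Defs where

open import Data.Nat using (ℕ; _*_; _<_)
open import Data.Fin using (Fin)
open import Data.List using (List; []; _∷_; _++_; length; allFin)
open import Data.List.Membership.Propositional using (_∈_)
open import Data.List.Relation.Unary.All using (All)
open import Data.List.Relation.Unary.Unique.Propositional using (Unique)
open import Data.List.Relation.Binary.Permutation.Propositional using (_↭_)
open import Data.Product using (Σ; _×_; ∃)
open import Data.Sum using (_⊎_)
open import Relation.Binary.PropositionalEquality using (_≡_; _≢_)
open import Relation.Nullary using (¬_)

data Tree (n : ℕ) : Set where
  leaf : Fin n → Tree n
  node : Tree n → Tree n → Tree n

leaves : ∀ {n} → Tree n → List (Fin n)
leaves (leaf x)   = x ∷ []
leaves (node l r) = leaves l ++ leaves r

-- s is (the subtree rooted at) a node of t
data _≼_ {n : ℕ} : Tree n → Tree n → Set where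
  here  : ∀ {t} → t ≼ t
  left  : ∀ {s l r} → s ≼ l → s ≼ node l r
  right : ∀ {s l r} → s ≼ r → s ≼ node l r

IsHierarchicalClustering : ∀ {n} → Tree n → Set
IsHierarchicalClustering {n} t = leaves t ↭ allFin n

InCluster : ∀ {n} → Fin n → Tree n → Set
InCluster x s = x ∈ leaves s

Closer : ∀ {n} → Tree n → Fin n → Fin n → Fin n → Set
Closer T x x' x'' =
  (x ≢ x') × (x ≢ x'') × (x' ≢ x'') ×
  Σ (Tree _) (λ s → (s ≼ T) × InCluster x s × InCluster x' s × ¬ InCluster x'' s)

InA : ∀ {n} → Tree n → Fin n → Fin n → Fin n → Set
InA T xA xB x = (x ≡ xA) ⊎ Closer T x xA xB

InB : ∀ {n} → Tree n → Fin n → Fin n → Fin n → Set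
InB T xA xB x = (x ≡ xB) ⊎ Closer T x xB xA

InC : ∀ {n} → Tree n → Fin n → Fin n → Fin n → Set
InC T xA xB x = Closer T xA xB x

MoreThan15/16 : (n : ℕ) → (Fin n → Set) → Set
MoreThan15/16 n P =
  Σ (List (Fin n)) (λ l → Unique l × All P l × (15 * n < 16 * length l))

Bad : ∀ {n} → Tree n → Fin n → Fin n → Set
Bad {n} T xA xB =
  MoreThan15/16 n (InA T xA xB) ⊎ MoreThan15/16 n (InB T xA xB) ⊎
  MoreThan15/16 n (InC T xA xB)

BadPair : ∀ {n} → Tree n → Fin n × Fin n → Set
BadPair T (xA Data.Product., xB) = (xA ≢ xB) × Bad T xA xB

module Submission where

-- Every pair (xA , xB) of distinct elements is separated at some node v = node l r of T
-- (xA in one child, xB in the other).  Laminarity of clusters then gives A ⊆ l, B ⊆ r and C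
-- disjoint from v.  Hence (xA , xB) can only be bad when v is unbalanced: a child has more
-- than 15n/16 leaves, or v has fewer than n/16.  So all bad pairs lie in the list
-- 'candidates T' of pairs separated at unbalanced nodes, and it suffices to bound its
-- length 'count T'.  Writing s for the size of a subtree t, three bounds hold by induction:
--   (a) count t ≤ s²;
--   (b) if 16 s ≤ 15 n (t is small), then 16 count t ≤ n s;
--   (c) if 15 n < 16 s ≤ 16 n (t is large), then 16 count t + 30 n² ≤ 33 n s.
-- A large node has at most one large child; (c) follows from (c) for that child and (b) for
-- the other, and if there is no large child the node is balanced and (b) applies to both.
-- At the root (s = n) this yields count T ≤ 3n²/16 ≤ (125/128) n (n-1) for n ≥ 3.
-- The file develops, in order: list facts (pigeonhole), tree facts (laminarity), the location
-- of A, B, C at a separating node, the candidate list, the arithmetic of (a)-(c), and lemma5.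

open import Defs
open import Data.Nat using (ℕ; suc; _*_; _+_; _∸_; _≤_; _<_; s≤s; z≤n; _≤?_; _<?_)
open import Data.Nat.Properties
open import Data.Nat.Tactic.RingSolver using (solve-∀)
open import Data.Fin using (Fin)
open import Data.List using (List; []; _∷_; _++_; length; map; allFin; cartesianProduct)
open import Data.List.Properties using (length-++; length-++-sucʳ; length-map; length-tabulate)
open import Data.List.Membership.Propositional using (_∈_; _∉_)
open import Data.List.Membership.Propositional.Properties
  using (∈-++⁺ˡ; ∈-++⁺ʳ; ∈-++⁻; ∈-∃++; ∈-allFin; ∈-cartesianProduct⁺)
open import Data.List.Relation.Unary.All as All using (All; []; _∷_)
import Data.List.Relation.Unary.All.Properties as All
open import Data.List.Relation.Unary.Any using (here; there)
open import Data.List.Relation.Unary.AllPairs using ([]; _∷_)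
open import Data.List.Relation.Unary.Unique.Propositional using (Unique)
import Data.List.Relation.Unary.Unique.Propositional.Properties as Unique
open import Data.List.Relation.Binary.Permutation.Propositional using (↭-sym; ↭⇒↭ₛ)
open import Data.List.Relation.Binary.Permutation.Propositional.Properties
  using (Any-resp-↭; ↭-length)
import Data.List.Relation.Binary.Permutation.Setoid.Properties as PermutationSetoid
open import Data.Product using (_×_; _,_)
open import Data.Sum using (_⊎_; inj₁; inj₂)
open import Data.Empty using (⊥-elim)
open import Function using (_∘_)
open import Relation.Binary.PropositionalEquality
open import Relation.Nullary using (¬_; Dec; yes; no)
open import Relation.Nullary.Decidable using (_×-dec_)

module _ {A : Set} where

  unique-++ˡ : (xs : List A) {ys : List A} → Unique (xs ++ ys) → Unique xs
  unique-++ˡ []       _          = []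
  unique-++ˡ (x ∷ xs) (x∉ ∷ u)   = All.++⁻ˡ xs x∉ ∷ unique-++ˡ xs u

  unique-++ʳ : (xs : List A) {ys : List A} → Unique (xs ++ ys) → Unique ys
  unique-++ʳ []       u        = u
  unique-++ʳ (x ∷ xs) (_ ∷ u)  = unique-++ʳ xs u

  unique-++-disjoint : (xs : List A) {ys : List A} {z : A} →
                       Unique (xs ++ ys) → z ∈ xs → z ∉ ys
  unique-++-disjoint (x ∷ xs) (x∉ ∷ u) (here refl) z∈ys = All.lookup x∉ (∈-++⁺ʳ xs z∈ys) refl
  unique-++-disjoint (x ∷ xs) (_ ∷ u)  (there z∈xs) z∈ys = unique-++-disjoint xs u z∈xs z∈ys

  ∈-remove : (as : List A) {bs : List A} {x y : A} → y ∈ as ++ x ∷ bs → y ≢ x → y ∈ as ++ bs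
  ∈-remove []       (here refl) y≢x = ⊥-elim (y≢x refl)
  ∈-remove []       (there y∈)  _   = y∈
  ∈-remove (a ∷ as) (here refl) _   = here refl
  ∈-remove (a ∷ as) (there y∈)  y≢x = there (∈-remove as y∈ y≢x)

  unique-length-≤ : (xs ys : List A) → Unique xs → All (_∈ ys) xs → length xs ≤ length ys
  unique-length-≤ []       ys _          _               = z≤n
  unique-length-≤ (x ∷ xs) ys (x∉xs ∷ u) (x∈ys ∷ xs⊆ys) with ∈-∃++ x∈ys
  ... | as , bs , refl =
    ≤-trans (s≤s (unique-length-≤ xs (as ++ bs) u xs⊆as++bs))
            (≤-reflexive (sym (length-++-sucʳ as x bs)))
    where
    xs⊆as++bs : All (_∈ as ++ bs) xs
    xs⊆as++bs = All.zipWith (λ (y∈ , x≢y) → ∈-remove as y∈ (x≢y ∘ sym)) (xs⊆ys , x∉xs)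

  length-cartesianProduct : {B : Set} (xs : List A) (ys : List B) →
                            length (cartesianProduct xs ys) ≡ length xs * length ys
  length-cartesianProduct []       ys = refl
  length-cartesianProduct (x ∷ xs) ys = begin
    length (map (x ,_) ys ++ cartesianProduct xs ys)         ≡⟨ length-++ (map (x ,_) ys) ⟩
    length (map (x ,_) ys) + length (cartesianProduct xs ys) ≡⟨ cong₂ _+_ (length-map (x ,_) ys)
                                                                   (length-cartesianProduct xs ys) ⟩
    length ys + length xs * length ys                         ∎
    where open ≡-Reasoning

unless : {P : Set} {A : Set} → Dec P → List A → List A
unless (yes _) xs = []
unless (no _)  xs = xs

length-unless-≤ : {P A : Set} (P? : Dec P) (xs : List A) → length (unless P? xs) ≤ length xs
length-unless-≤ (yes _) xs = z≤n
length-unless-≤ (no _)  xs = ≤-refl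

∈-unless : {P A : Set} (P? : Dec P) {xs : List A} {x : A} → ¬ P → x ∈ xs → x ∈ unless P? xs
∈-unless (yes p) ¬p _  = ⊥-elim (¬p p)
∈-unless (no _)  _  x∈ = x∈

module _ {n : ℕ} where

  size : Tree n → ℕ
  size (leaf _)   = 1
  size (node l r) = size l + size r

  length-leaves : (t : Tree n) → length (leaves t) ≡ size t
  length-leaves (leaf _)   = refl
  length-leaves (node l r) =
    trans (length-++ (leaves l)) (cong₂ _+_ (length-leaves l) (length-leaves r))

  ≼-trans : {s t v : Tree n} → s ≼ t → t ≼ v → s ≼ v
  ≼-trans s≼t here      = s≼t
  ≼-trans s≼t (left p)  = left (≼-trans s≼t p)
  ≼-trans s≼t (right p) = right (≼-trans s≼t p)

  ≼-leaves : {s t : Tree n} {x : Fin n} → s ≼ t → x ∈ leaves s → x ∈ leaves t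
  ≼-leaves here            x∈ = x∈
  ≼-leaves (left p)        x∈ = ∈-++⁺ˡ (≼-leaves p x∈)
  ≼-leaves (right {l = l} p) x∈ = ∈-++⁺ʳ (leaves l) (≼-leaves p x∈)

  ≼-unique : {s t : Tree n} → s ≼ t → Unique (leaves t) → Unique (leaves s)
  ≼-unique here              u = u
  ≼-unique (left {l = l} p)  u = ≼-unique p (unique-++ˡ (leaves l) u)
  ≼-unique (right {l = l} p) u = ≼-unique p (unique-++ʳ (leaves l) u)

  laminar : {s v t : Tree n} {x : Fin n} → Unique (leaves t) → s ≼ t → v ≼ t →
            x ∈ leaves s → x ∈ leaves v → s ≼ v ⊎ v ≼ s
  laminar u here      v≼t        _ _ = inj₂ v≼t
  laminar u (left p)  here       _ _ = inj₁ (left p)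
  laminar u (right p) here       _ _ = inj₁ (right p)
  laminar {t = node l r} u (left p)  (left q)  x∈s x∈v = laminar (unique-++ˡ (leaves l) u) p q x∈s x∈v
  laminar {t = node l r} u (right p) (right q) x∈s x∈v = laminar (unique-++ʳ (leaves l) u) p q x∈s x∈v
  laminar {t = node l r} u (left p)  (right q) x∈s x∈v =
    ⊥-elim (unique-++-disjoint (leaves l) u (≼-leaves p x∈s) (≼-leaves q x∈v))
  laminar {t = node l r} u (right p) (left q)  x∈s x∈v =
    ⊥-elim (unique-++-disjoint (leaves l) u (≼-leaves q x∈v) (≼-leaves p x∈s))

  clustering-unique : (T : Tree n) → IsHierarchicalClustering T → Unique (leaves T)
  clustering-unique T h =
    PermutationSetoid.Unique-resp-↭ (setoid (Fin n)) (↭⇒↭ₛ (↭-sym h)) (Unique.allFin⁺ n)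

  clustering-complete : (T : Tree n) → IsHierarchicalClustering T → (x : Fin n) → x ∈ leaves T
  clustering-complete T h x = Any-resp-↭ (↭-sym h) (∈-allFin x)

  clustering-size : (T : Tree n) → IsHierarchicalClustering T → size T ≡ n
  clustering-size T h =
    trans (sym (length-leaves T)) (trans (↭-length h) (length-tabulate (λ i → i)))

  data Children : Tree n → Tree n → Tree n → Set where
    left-right : {l r : Tree n} → Children (node l r) l r
    right-left : {l r : Tree n} → Children (node l r) r l

  children-swap : {v c d : Tree n} → Children v c d → Children v d c
  children-swap left-right = right-left
  children-swap right-left = left-right

  child-≼ : {v c d : Tree n} → Children v c d → c ≼ v
  child-≼ left-right = left here
  child-≼ right-left = right here

  children-disjoint : {v c d : Tree n} {x : Fin n} → Unique (leaves v) → Children v c d →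
                      x ∈ leaves c → x ∉ leaves d
  children-disjoint {node l r} u left-right x∈c x∈d = unique-++-disjoint (leaves l) u x∈c x∈d
  children-disjoint {node l r} u right-left x∈c x∈d = unique-++-disjoint (leaves l) u x∈d x∈c

  below-children : {s v c d : Tree n} → Children v c d → s ≼ v → s ≡ v ⊎ s ≼ c ⊎ s ≼ d
  below-children left-right here      = inj₁ refl
  below-children left-right (left p)  = inj₂ (inj₁ p)
  below-children left-right (right p) = inj₂ (inj₂ p)
  below-children right-left here      = inj₁ refl
  below-children right-left (left p)  = inj₂ (inj₂ p)
  below-children right-left (right p) = inj₂ (inj₁ p)

module Separated {n : ℕ} {T : Tree n} (u : Unique (leaves T)) where

  cluster-below-child : {v c d s : Tree n} {x y : Fin n} → v ≼ T → Children v c d → s ≼ T →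
                        x ∈ leaves c → y ∈ leaves d → x ∈ leaves s → y ∉ leaves s → s ≼ c
  cluster-below-child vT ch sT x∈c y∈d x∈s y∉s
    with laminar u sT vT x∈s (≼-leaves (child-≼ ch) x∈c)
  ... | inj₂ v≼s = ⊥-elim (y∉s (≼-leaves v≼s (≼-leaves (child-≼ (children-swap ch)) y∈d)))
  ... | inj₁ s≼v with below-children ch s≼v
  ...   | inj₁ refl       = ⊥-elim (y∉s (≼-leaves (child-≼ (children-swap ch)) y∈d))
  ...   | inj₂ (inj₁ s≼c) = s≼c
  ...   | inj₂ (inj₂ s≼d) = ⊥-elim (children-disjoint (≼-unique vT u) ch x∈c (≼-leaves s≼d x∈s))

  cluster-above-node : {v c d s : Tree n} {x y : Fin n} → v ≼ T → Children v c d → s ≼ T →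
                       x ∈ leaves c → y ∈ leaves d → x ∈ leaves s → y ∈ leaves s → v ≼ s
  cluster-above-node vT ch sT x∈c y∈d x∈s y∈s
    with laminar u sT vT x∈s (≼-leaves (child-≼ ch) x∈c)
  ... | inj₂ v≼s = v≼s
  ... | inj₁ s≼v with below-children ch s≼v
  ...   | inj₁ refl       = here
  ...   | inj₂ (inj₁ s≼c) = ⊥-elim (children-disjoint (≼-unique vT u) ch (≼-leaves s≼c y∈s) y∈d)
  ...   | inj₂ (inj₂ s≼d) = ⊥-elim (children-disjoint (≼-unique vT u) ch x∈c (≼-leaves s≼d x∈s))

  A-⊆-child : {v c d : Tree n} {xA xB x : Fin n} → v ≼ T → Children v c d →
              xA ∈ leaves c → xB ∈ leaves d → InA T xA xB x → x ∈ leaves c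
  A-⊆-child vT ch a b (inj₁ refl) = a
  A-⊆-child vT ch a b (inj₂ (_ , _ , _ , s , sT , x∈s , xA∈s , xB∉s)) =
    ≼-leaves (cluster-below-child vT ch sT a b xA∈s xB∉s) x∈s

  C-outside-node : {v c d : Tree n} {xA xB x : Fin n} → v ≼ T → Children v c d →
                   xA ∈ leaves c → xB ∈ leaves d → InC T xA xB x → x ∉ leaves v
  C-outside-node vT ch a b (_ , _ , _ , s , sT , xA∈s , xB∈s , x∉s) x∈v =
    x∉s (≼-leaves (cluster-above-node vT ch sT a b xA∈s xB∈s) x∈v)

not-more-than-inside : {n : ℕ} (P : Fin n → Set) (c : List (Fin n)) → (∀ {x} → P x → x ∈ c) →
                       16 * length c ≤ 15 * n → ¬ MoreThan15/16 n P
not-more-than-inside P c P⊆c c-small (xs , uxs , xs⊆P , big) =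
  <⇒≱ big (≤-trans (*-monoʳ-≤ 16 (unique-length-≤ xs c uxs (All.map P⊆c xs⊆P))) c-small)

not-more-than-outside : {n : ℕ} (P : Fin n → Set) (c : List (Fin n)) → Unique c →
                        (∀ {x} → P x → x ∉ c) → n ≤ 16 * length c → ¬ MoreThan15/16 n P
not-more-than-outside {n} P c uc P∩c=∅ c-large (xs , uxs , xs⊆P , big) =
  <⇒≱ (subst₂ _<_ (+-comm (15 * n) n) (sym (*-distribˡ-+ 16 (length xs) (length c))) (+-mono-<-≤ big c-large))
      (*-monoʳ-≤ 16 (subst (_≤ n) (length-++ xs) xs++c-fits))
  where
  xs++c-fits : length (xs ++ c) ≤ n
  xs++c-fits = subst (length (xs ++ c) ≤_) (length-tabulate (λ i → i))
    (unique-length-≤ (xs ++ c) (allFin n)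
      (Unique.++⁺ uxs uc (λ (x∈xs , x∈c) → P∩c=∅ (All.lookup xs⊆P x∈xs) x∈c))
      (All.universal ∈-allFin _))

-- Badness is symmetric: swapping xA and xB swaps A and B and leaves C unchanged.
bad-swap : {n : ℕ} {T : Tree n} {xA xB : Fin n} → Bad T xA xB → Bad T xB xA
bad-swap (inj₁ A-big)                 = inj₂ (inj₁ A-big)
bad-swap (inj₂ (inj₁ B-big))          = inj₁ B-big
bad-swap (inj₂ (inj₂ (xs , u , C , big))) = inj₂ (inj₂ (xs , u , All.map closer-swap C , big))
  where
  closer-swap : ∀ {T : Tree _} {x y z} → Closer T x y z → Closer T y x z
  closer-swap (x≢y , x≢z , y≢z , s , sT , x∈s , y∈s , z∉s) =
    (x≢y ∘ sym) , y≢z , x≢z , s , sT , y∈s , x∈s , z∉s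

Balanced : {n : ℕ} → Tree n → Tree n → Set
Balanced {n} l r = (16 * size l ≤ 15 * n) × (16 * size r ≤ 15 * n) × (n ≤ 16 * (size l + size r))

balanced? : {n : ℕ} (l r : Tree n) → Dec (Balanced l r)
balanced? {n} l r =
  (16 * size l ≤? 15 * n) ×-dec (16 * size r ≤? 15 * n) ×-dec (n ≤? 16 * (size l + size r))

separated-not-bad : {n : ℕ} {T l r : Tree n} {xA xB : Fin n} → Unique (leaves T) →
                    node l r ≼ T → Balanced l r → xA ∈ leaves l → xB ∈ leaves r → ¬ Bad T xA xB
separated-not-bad {n} {T} {l} {r} u vT (l-small , r-small , v-large) a b = λ
  { (inj₁ A-big) → not-more-than-inside _ (leaves l)
      (A-⊆-child vT left-right a b) (by-length l l-small) A-big
  ; (inj₂ (inj₁ B-big)) → not-more-than-inside _ (leaves r)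
      (A-⊆-child vT right-left b a) (by-length r r-small) B-big
  ; (inj₂ (inj₂ C-big)) → not-more-than-outside _ (leaves (node l r)) (≼-unique vT u)
      (C-outside-node vT left-right a b)
      (subst (λ k → n ≤ 16 * k) (sym (length-leaves (node l r))) v-large) C-big }
  where
  open Separated {T = T} u
  by-length : (t : Tree n) → 16 * size t ≤ 15 * n → 16 * length (leaves t) ≤ 15 * n
  by-length t = subst (λ k → 16 * k ≤ 15 * n) (sym (length-leaves t))

module _ {n : ℕ} where

  crossPairs : Tree n → Tree n → List (Fin n × Fin n)
  crossPairs l r = cartesianProduct (leaves l) (leaves r) ++ cartesianProduct (leaves r) (leaves l)

  candidates : Tree n → List (Fin n × Fin n)
  candidates (leaf _)   = []
  candidates (node l r) = unless (balanced? l r) (crossPairs l r) ++ candidates l ++ candidates r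

  count : Tree n → ℕ
  count t = length (candidates t)

  bad-∈-candidates : {T t : Tree n} {xA xB : Fin n} → Unique (leaves T) → t ≼ T → xA ≢ xB →
                     Bad T xA xB → xA ∈ leaves t → xB ∈ leaves t → (xA , xB) ∈ candidates t
  bad-∈-candidates {t = leaf _} u tT xA≢xB bad (here refl) (here refl) = ⊥-elim (xA≢xB refl)
  bad-∈-candidates {t = node l r} u tT xA≢xB bad a b with ∈-++⁻ (leaves l) a | ∈-++⁻ (leaves l) b
  ... | inj₁ a∈l | inj₁ b∈l = ∈-++⁺ʳ (unless (balanced? l r) _)
          (∈-++⁺ˡ (bad-∈-candidates u (≼-trans (left here) tT) xA≢xB bad a∈l b∈l))
  ... | inj₂ a∈r | inj₂ b∈r = ∈-++⁺ʳ (unless (balanced? l r) _)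
          (∈-++⁺ʳ (candidates l) (bad-∈-candidates u (≼-trans (right here) tT) xA≢xB bad a∈r b∈r))
  ... | inj₁ a∈l | inj₂ b∈r = ∈-++⁺ˡ (∈-unless (balanced? l r)
          (λ bal → separated-not-bad u tT bal a∈l b∈r bad)
          (∈-++⁺ˡ (∈-cartesianProduct⁺ a∈l b∈r)))
  ... | inj₂ a∈r | inj₁ b∈l = ∈-++⁺ˡ (∈-unless (balanced? l r)
          (λ bal → separated-not-bad u tT bal b∈l a∈r (bad-swap bad))
          (∈-++⁺ʳ (cartesianProduct (leaves l) (leaves r)) (∈-cartesianProduct⁺ a∈r b∈l)))

  length-crossPairs : (l r : Tree n) → length (crossPairs l r) ≡ 2 * (size l * size r)
  length-crossPairs l r = begin
    length (crossPairs l r)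
      ≡⟨ length-++ (cartesianProduct (leaves l) (leaves r)) ⟩
    length (cartesianProduct (leaves l) (leaves r)) + length (cartesianProduct (leaves r) (leaves l))
      ≡⟨ cong₂ _+_ (length-cartesianProduct (leaves l) (leaves r))
                   (length-cartesianProduct (leaves r) (leaves l)) ⟩
    length (leaves l) * length (leaves r) + length (leaves r) * length (leaves l)
      ≡⟨ cong₂ (λ a b → a * b + b * a) (length-leaves l) (length-leaves r) ⟩
    size l * size r + size r * size l
      ≡⟨ double (size l) (size r) ⟩
    2 * (size l * size r) ∎
    where
    open ≡-Reasoning
    double : ∀ a b → a * b + b * a ≡ 2 * (a * b)
    double = solve-∀

  count-node-≤ : (l r : Tree n) → count (node l r) ≤ 2 * (size l * size r) + (count l + count r)
  count-node-≤ l r = begin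
    count (node l r)
      ≡⟨ length-++ (unless (balanced? l r) (crossPairs l r)) ⟩
    length (unless (balanced? l r) (crossPairs l r)) + length (candidates l ++ candidates r)
      ≡⟨ cong (length (unless (balanced? l r) (crossPairs l r)) +_) (length-++ (candidates l)) ⟩
    length (unless (balanced? l r) (crossPairs l r)) + (count l + count r)
      ≤⟨ +-monoˡ-≤ (count l + count r) (length-unless-≤ (balanced? l r) (crossPairs l r)) ⟩
    length (crossPairs l r) + (count l + count r)
      ≡⟨ cong (_+ (count l + count r)) (length-crossPairs l r) ⟩
    2 * (size l * size r) + (count l + count r) ∎
    where open ≤-Reasoning

  count-balanced : (l r : Tree n) → Balanced l r → count (node l r) ≡ count l + count r
  count-balanced l r bal with balanced? l r
  ... | yes _    = length-++ (candidates l)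
  ... | no ¬bal  = ⊥-elim (¬bal bal)

  count-children-≤ : {v c d : Tree n} → Children v c d →
                     count v ≤ 2 * (size c * size d) + (count c + count d)
  count-children-≤ {node l r} left-right = count-node-≤ l r
  count-children-≤ {node l r} right-left =
    subst (count (node l r) ≤_) (swap-sides (size l) (size r) (count l) (count r)) (count-node-≤ l r)
    where
    swap-sides : ∀ a b x y → 2 * (a * b) + (x + y) ≡ 2 * (b * a) + (y + x)
    swap-sides = solve-∀

  size-children : {v c d : Tree n} → Children v c d → size c + size d ≡ size v
  size-children left-right = refl
  size-children {node l r} right-left = +-comm (size r) (size l)

square-step : ∀ {N} Na Nb a b → N ≤ 2 * (a * b) + (Na + Nb) → Na ≤ a * a → Nb ≤ b * b →
              N ≤ (a + b) * (a + b)
square-step {N} Na Nb a b N≤ Na≤ Nb≤ = begin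
  N                             ≤⟨ N≤ ⟩
  2 * (a * b) + (Na + Nb)       ≤⟨ +-monoʳ-≤ (2 * (a * b)) (+-mono-≤ Na≤ Nb≤) ⟩
  2 * (a * b) + (a * a + b * b) ≡⟨ square-of-sum a b ⟩
  (a + b) * (a + b)             ∎
  where
  open ≤-Reasoning
  square-of-sum : ∀ a b → 2 * (a * b) + (a * a + b * b) ≡ (a + b) * (a + b)
  square-of-sum = solve-∀

small-step : ∀ Na Nb a b n → 16 * Na ≤ n * a → 16 * Nb ≤ n * b → 16 * (Na + Nb) ≤ n * (a + b)
small-step Na Nb a b n Na≤ Nb≤ = begin
  16 * (Na + Nb)    ≡⟨ *-distribˡ-+ 16 Na Nb ⟩
  16 * Na + 16 * Nb ≤⟨ +-mono-≤ Na≤ Nb≤ ⟩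
  n * a + n * b     ≡⟨ *-distribˡ-+ n a b ⟨
  n * (a + b)       ∎
  where open ≤-Reasoning

tiny-bound : ∀ {N} s n → N ≤ s * s → 16 * s < n → 16 * N ≤ n * s
tiny-bound {N} s n N≤ tiny = begin
  16 * N       ≤⟨ *-monoʳ-≤ 16 N≤ ⟩
  16 * (s * s) ≡⟨ *-assoc 16 s s ⟨
  16 * s * s   ≤⟨ *-monoˡ-≤ s (<⇒≤ tiny) ⟩
  n * s        ∎
  where open ≤-Reasoning

sibling-small : ∀ a b n → 15 * n < 16 * a → a + b ≤ n → 16 * b ≤ 15 * n
sibling-small a b n a-large fits = ≤-trans (<⇒≤ (+-cancelˡ-< (15 * n) (16 * b) n lt)) (m≤n*m n 15)
  where
  open ≤-Reasoning
  lt : 15 * n + 16 * b < 15 * n + n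
  lt = begin-strict
    15 * n + 16 * b  <⟨ +-monoˡ-< (16 * b) a-large ⟩
    16 * a + 16 * b  ≡⟨ *-distribˡ-+ 16 a b ⟨
    16 * (a + b)     ≤⟨ *-monoʳ-≤ 16 fits ⟩
    16 * n           ≡⟨ +-comm n (15 * n) ⟩
    15 * n + n       ∎

large-step : ∀ {N} Na Nb a b n → N ≤ 2 * (a * b) + (Na + Nb) → a ≤ n →
             16 * Na + 30 * (n * n) ≤ 33 * (n * a) → 16 * Nb ≤ n * b →
             16 * N + 30 * (n * n) ≤ 33 * (n * (a + b))
large-step {N} Na Nb a b n N≤ a≤n Na≤ Nb≤ = begin
  16 * N + 30 * (n * n)
    ≤⟨ +-monoˡ-≤ (30 * (n * n)) (*-monoʳ-≤ 16 N≤) ⟩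
  16 * (2 * (a * b) + (Na + Nb)) + 30 * (n * n)
    ≡⟨ regroup Na Nb a b n ⟩
  32 * (a * b) + 16 * Nb + (16 * Na + 30 * (n * n))
    ≤⟨ +-mono-≤ (+-mono-≤ (*-monoʳ-≤ 32 (*-monoˡ-≤ b a≤n)) Nb≤) Na≤ ⟩
  32 * (n * b) + n * b + 33 * (n * a)
    ≡⟨ collect a b n ⟩
  33 * (n * (a + b)) ∎
  where
  open ≤-Reasoning
  regroup : ∀ Na Nb a b n → 16 * (2 * (a * b) + (Na + Nb)) + 30 * (n * n) ≡
                            32 * (a * b) + 16 * Nb + (16 * Na + 30 * (n * n))
  regroup = solve-∀
  collect : ∀ a b n → 32 * (n * b) + n * b + 33 * (n * a) ≡ 33 * (n * (a + b))
  collect = solve-∀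

large-from-small : ∀ N s n → 16 * N ≤ n * s → 15 * n < 16 * s → 16 * N + 30 * (n * n) ≤ 33 * (n * s)
large-from-small N s n N≤ large = begin
  16 * N + 30 * (n * n)       ≡⟨ cong (16 * N +_) (split-square n) ⟩
  16 * N + (2 * n) * (15 * n) ≤⟨ +-mono-≤ N≤ (*-monoʳ-≤ (2 * n) (<⇒≤ large)) ⟩
  n * s + (2 * n) * (16 * s)  ≡⟨ collect n s ⟩
  33 * (n * s)                ∎
  where
  open ≤-Reasoning
  split-square : ∀ n → 30 * (n * n) ≡ (2 * n) * (15 * n)
  split-square = solve-∀
  collect : ∀ n s → n * s + (2 * n) * (16 * s) ≡ 33 * (n * s)
  collect = solve-∀

-- (c) for a leaf: a single leaf is large only when n ≤ 1.
large-leaf : ∀ n → 15 * n < 16 * 1 → 16 * 0 + 30 * (n * n) ≤ 33 * (n * 1)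
large-leaf 0            _     = z≤n
large-leaf 1            _     = m≤m+n 30 3
large-leaf (suc (suc n)) large =
  ⊥-elim (<⇒≱ large (≤-trans (m≤m+n 16 14) (*-monoʳ-≤ 15 (s≤s (s≤s z≤n)))))

whole-large : ∀ n → 1 ≤ n → 15 * n < 16 * n
whole-large (suc k) _ = *-monoˡ-< (suc k) {15} {16} ≤-refl

-- (c) at the root of T turns into the claimed probability bound: 128 N ≤ 24 n² ≤ 125 n (n - 1).
root-bound : ∀ N n → 3 ≤ n → 16 * N + 30 * (n * n) ≤ 33 * (n * n) → 128 * N ≤ 125 * (n * (n ∸ 1))
root-bound N (suc (suc (suc m))) (s≤s (s≤s (s≤s _))) root = begin
  128 * N           ≡⟨ *-assoc 8 16 N ⟩
  8 * (16 * N)      ≤⟨ *-monoʳ-≤ 8 16N≤ ⟩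
  8 * (3 * (n * n)) ≡⟨ regroup n ⟩
  n * (24 * n)      ≤⟨ *-monoʳ-≤ n 24n≤ ⟩
  n * (125 * k)     ≡⟨ *-left-comm n 125 k ⟩
  125 * (n * k)     ∎
  where
  open ≤-Reasoning
  k = suc (suc m)
  n = suc k
  16N≤ : 16 * N ≤ 3 * (n * n)
  16N≤ = +-cancelʳ-≤ (30 * (n * n)) (16 * N) (3 * (n * n)) (≤-trans root (≤-reflexive (split n)))
    where
    split : ∀ n → 33 * (n * n) ≡ 3 * (n * n) + 30 * (n * n)
    split = solve-∀
  regroup : ∀ n → 8 * (3 * (n * n)) ≡ n * (24 * n)
  regroup = solve-∀
  *-left-comm : ∀ a b c → a * (b * c) ≡ b * (a * c)
  *-left-comm = solve-∀
  24n≤ : 24 * n ≤ 125 * k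
  24n≤ = ≤-trans (m≤m+n (24 * n) (178 + 101 * m)) (≤-reflexive (slack m))
    where
    slack : ∀ m → 24 * suc (suc (suc m)) + (178 + 101 * m) ≡ 125 * suc (suc m)
    slack = solve-∀

module _ {n : ℕ} where

  count-≤-square : (t : Tree n) → count t ≤ size t * size t
  count-≤-square (leaf _)   = z≤n
  count-≤-square (node l r) =
    square-step (count l) (count r) (size l) (size r)
      (count-node-≤ l r) (count-≤-square l) (count-≤-square r)

  count-small : (t : Tree n) → 16 * size t ≤ 15 * n → 16 * count t ≤ n * size t
  count-balanced-small : (l r : Tree n) → Balanced l r → 16 * count (node l r) ≤ n * (size l + size r)

  count-small (leaf _)   _     = z≤n
  count-small (node l r) small with 16 * (size l + size r) <? n
  ... | yes tiny    = tiny-bound (size l + size r) n (count-≤-square (node l r)) tiny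
  ... | no  ¬tiny   = count-balanced-small l r (child small (m≤m+n (size l) (size r)) ,
                                               child small (m≤n+m (size r) (size l)) , ≮⇒≥ ¬tiny)
    where
    child : ∀ {c s} → 16 * s ≤ 15 * n → c ≤ s → 16 * c ≤ 15 * n
    child s-small c≤s = ≤-trans (*-monoʳ-≤ 16 c≤s) s-small

  count-balanced-small l r bal@(l-small , r-small , _) =
    subst (λ N → 16 * N ≤ n * (size l + size r)) (sym (count-balanced l r bal))
      (small-step (count l) (count r) (size l) (size r) n
        (count-small l l-small) (count-small r r-small))

  count-large : (t : Tree n) → size t ≤ n → 15 * n < 16 * size t →
                16 * count t + 30 * (n * n) ≤ 33 * (n * size t)
  -- (c) at a node with a large child c, from (c) for c and (b) for its (necessarily tiny) sibling.
  through-large-child : {v c d : Tree n} → Children v c d →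
                        (size c ≤ n → 15 * n < 16 * size c →
                         16 * count c + 30 * (n * n) ≤ 33 * (n * size c)) →
                        size v ≤ n → 15 * n < 16 * size c →
                        16 * count v + 30 * (n * n) ≤ 33 * (n * size v)

  count-large (leaf _)   _    large = large-leaf n large
  count-large (node l r) fits large with 15 * n <? 16 * size l | 15 * n <? 16 * size r
  ... | yes l-large | _         = through-large-child {node l r} left-right (count-large l) fits l-large
  ... | no _        | yes r-large = through-large-child {node l r} right-left (count-large r) fits r-large
  ... | no ¬l-large | no ¬r-large =
    large-from-small (count (node l r)) (size l + size r) n
      (count-balanced-small l r (≮⇒≥ ¬l-large , ≮⇒≥ ¬r-large , ≤-trans (m≤n*m n 15) (<⇒≤ large)))
      large

  through-large-child {v} {c} {d} ch c-bound v-fits c-large =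
    subst (λ s → 16 * count v + 30 * (n * n) ≤ 33 * (n * s)) (size-children ch)
      (large-step (count c) (count d) (size c) (size d) n (count-children-≤ ch) c≤n
        (c-bound c≤n c-large) (count-small d (sibling-small (size c) (size d) n c-large fits)))
    where
    fits : size c + size d ≤ n
    fits = subst (_≤ n) (sym (size-children ch)) v-fits
    c≤n : size c ≤ n
    c≤n = ≤-trans (m≤m+n (size c) (size d)) fits

-- The theorem: with probability at most 125/128 a uniformly random ordered pair of distinct
-- elements is bad, i.e. 128 · #(bad pairs) ≤ 125 · n (n - 1).

lemma5 : (n : ℕ) → 3 ≤ n → (T : Tree n) → IsHierarchicalClustering T →
    (bad : List (Fin n × Fin n)) → Unique bad → All (BadPair T) bad →
    128 * length bad ≤ 125 * (n * (n ∸ 1))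
lemma5 n 3≤n T clustering bad unique-bad all-bad =
  ≤-trans (*-monoʳ-≤ 128 bad≤count) (root-bound (count T) n 3≤n root)
  where
  u = clustering-unique T clustering
  size≡n = clustering-size T clustering

  -- every bad pair is a candidate at the root
  bad≤count : length bad ≤ count T
  bad≤count = unique-length-≤ bad (candidates T) unique-bad (All.map
    (λ { {xA , xB} (xA≢xB , isBad) → bad-∈-candidates u here xA≢xB isBad
           (clustering-complete T clustering xA) (clustering-complete T clustering xB) })
    all-bad)

  -- bound (c) for the whole tree, which is large since n ≥ 1
  root : 16 * count T + 30 * (n * n) ≤ 33 * (n * n)
  root = subst (λ s → 16 * count T + 30 * (n * n) ≤ 33 * (n * s)) size≡n
    (count-large T (≤-reflexive size≡n)
      (subst (λ s → 15 * n < 16 * s) (sym size≡n) (whole-large n (≤-trans (s≤s z≤n) 3≤n))))
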